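{- For all $\mathsf{PTSC}\alpha$ terms $M,N$: if $M\to_{\mathsf{Bx}'}N$ then $\mathcal B(M)\to_\beta^*\mathcal B(N)$; and for all lists $l,l'$ and every variable $y$: if $l\to_{\mathsf{Bx}'}l'$ then $\mathcal B^y(l)\to_\beta^*\mathcal B^y(l')$. (That is, $\beta$-reduction simulates $\mathsf{Bx}'$-reduction through the translation $\mathcal B$.)
   Context: Fix a set $\mathcal S$ of sorts, a denumerable set of variables, and two denumerable sets of meta-variables: term meta-variables $\alpha$ and list meta-variables $\beta$, each with a fixed arity $n$. $\mathsf{PTSC}\alpha$ terms and lists: $M ::= \Pi x^{A}.B \mid \lambda x^{A}.M \mid s \mid x\,l \mid M\,l \mid \langle N/x\rangle_A M \mid \alpha(M_1,\dots,M_n)$, $l ::= [\,] \mid M\cdot l \mid l @ l' \mid \langle N/x\rangle_A l \mid \beta(M_1,\dots,M_n)$, where $\langle N/x\rangle_A(\cdot)$ is explicit substitution (binding $x$) and $\Pi$, $\lambda$ bind $x$; up to $\alpha$-conversion. Reduction rules: (B) $(\lambda x^A.M)\,(N\cdot l)\to(\langle N/x\rangle_A M)\,l$, and the system $\mathsf{x}'$: (B1) $M\,[\,]\to M$; (B2) $(x\,l)\,l'\to x\,(l@l')$; (B3) $(M\,l)\,l'\to M\,(l@l')$; (A1) $(M\cdot l')@l\to M\cdot(l'@l)$; (A2) $[\,]@l\to l$; (A3) $(l@l')@l''\to l@(l'@l'')$; (A4) $l@[\,]\to l$; (C1) $\langle P/y\rangle_G(\lambda x^A.M)\to\lambda x^{\langle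 P/y\rangle_G A}.\langle P/y\rangle_G M$; (C2) $\langle P/y\rangle_G(y\,l)\to P\,(\langle P/y\rangle_G l)$; (C3) $\langle P/y\rangle_G(x\,l)\to x\,(\langle P/y\rangle_G l)$ if $x\neq y$; (C4) $\langle P/y\rangle_G(M\,l)\to(\langle P/y\rangle_G M)\,(\langle P/y\rangle_G l)$; (C5) $\langle P/y\rangle_G(\Pi x^A.B)\to\Pi x^{\langle P/y\rangle_G A}.\langle P/y\rangle_G B$; (C6) $\langle P/y\rangle_G s\to s$; (C$\alpha$) $\langle P/y\rangle_G\alpha(M_1,\dots,M_n)\to\alpha(\langle P/y\rangle_G M_1,\dots,\langle P/y\rangle_G M_n)$; (D1) $\langle P/y\rangle_G[\,]\to[\,]$; (D2) $\langle P/y\rangle_G(M\cdot l)\to(\langle P/y\rangle_G M)\cdot(\langle P/y\rangle_G l)$; (D3) $\langle P/y\rangle_G(l@l')\to(\langle P/y\rangle_G l)@(\langle P/y\rangle_G l')$; (D$\beta$) $\langle P/y\rangle_G\beta(M_1,\dots,M_n)\to\beta(\langle P/y\rangle_G M_1,\dots,\langle P/y\rangle_G M_n)$. $\to_{\mathsf{Bx}'}$ is the contextual closure of all these rules (capture avoidance understood). PTS terms: $t,u,T ::= x\mid s\mid \Pi x^T.t\mid\lambda x^T.t\mid t\,u$; $\to_\beta$ is the contextual closure of $(\lambda x^v.t)\,u\to t\{x:=u\}$, with $t\{x:=u\}$ capture-avoiding substitution. For each term (resp. list) meta-variable $\alpha$ (resp. $\beta$) of arity $k$ a PTS variable $\alpha^k$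 (resp. $\beta^k$) is reserved. Translation $\mathcal B$ from $\mathsf{PTSC}\alpha$ to PTS terms: $\mathcal B(\Pi x^A.B)=\Pi x^{\mathcal B(A)}.\mathcal B(B)$, $\mathcal B(\lambda x^A.M)=\lambda x^{\mathcal B(A)}.\mathcal B(M)$, $\mathcal B(s)=s$, $\mathcal B(x\,l)=\mathcal B^z(l)\{z:=x\}$, $\mathcal B(M\,l)=\mathcal B^z(l)\{z:=\mathcal B(M)\}$ ($z$ fresh), $\mathcal B(\langle P/x\rangle_K M)=\mathcal B(M)\{x:=\mathcal B(P)\}$, $\mathcal B(\alpha(M_1,\dots,M_n))=\alpha^n\,\mathcal B(M_1)\cdots\mathcal B(M_n)$; and for a variable $y$: $\mathcal B^y([\,])=y$, $\mathcal B^y(M\cdot l)=\mathcal B^z(l)\{z:=y\,\mathcal B(M)\}$, $\mathcal B^y(l@l')=\mathcal B^z(l')\{z:=\mathcal B^y(l)\}$ ($z$ fresh), $\mathcal B^y(\langle P/x\rangle_K l)=\mathcal B^y(l)\{x:=\mathcal B(P)\}$, $\mathcal B^y(\beta(M_1,\dots,M_n))=\beta^n\,y\,\mathcal B(M_1)\cdots\mathcal B(M_n)$. -}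

module Defs where

open import Data.Nat using (ℕ; zero; suc)
open import Data.Fin using (Fin; zero; suc)
open import Data.Vec using (Vec; []; _∷_)
import Data.Vec as V
open import Relation.Binary.Construct.Closure.ReflexiveTransitive using (Star)

-- Well-scoped de Bruijn syntax: a term of type  X S n  has n free variables
-- (Fin n); S is the (arbitrary) set of sorts.

variable
  S : Set
  n m k : ℕ

-- PTS terms  t ::= x | s | Π x^T.t | λ x^T.t | t u
-- plus the reserved PTS variables α^k / β^k for meta-variables: a term
-- (resp. list) meta-variable is a pair (name a, arity k); the reserved
-- variables are the never-bound atoms  tmv a k  /  lmv a k .

data PT (S : Set) : ℕ → Set where
  pvar  : Fin n → PT S n
  psort : S → PT S n
  pPi   : PT S n → PT S (suc n) → PT S n
  plam  : PT S n → PT S (suc n) → PT S n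
  papp  : PT S n → PT S n → PT S n
  tmv   : (a k : ℕ) → PT S n
  lmv   : (a k : ℕ) → PT S n

extR : (Fin n → Fin m) → Fin (suc n) → Fin (suc m)
extR ρ zero    = zero
extR ρ (suc i) = suc (ρ i)

renP : (Fin n → Fin m) → PT S n → PT S m
renP ρ (pvar x)   = pvar (ρ x)
renP ρ (psort s)  = psort s
renP ρ (pPi A B)  = pPi (renP ρ A) (renP (extR ρ) B)
renP ρ (plam A t) = plam (renP ρ A) (renP (extR ρ) t)
renP ρ (papp t u) = papp (renP ρ t) (renP ρ u)
renP ρ (tmv a k)  = tmv a k
renP ρ (lmv a k)  = lmv a k

extS : (Fin n → PT S m) → Fin (suc n) → PT S (suc m)
extS σ zero    = pvar zero
extS σ (suc i) = renP suc (σ i)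

subP : (Fin n → PT S m) → PT S n → PT S m
subP σ (pvar x)   = σ x
subP σ (psort s)  = psort s
subP σ (pPi A B)  = pPi (subP σ A) (subP (extS σ) B)
subP σ (plam A t) = plam (subP σ A) (subP (extS σ) t)
subP σ (papp t u) = papp (subP σ t) (subP σ u)
subP σ (tmv a k)  = tmv a k
subP σ (lmv a k)  = lmv a k

sub0 : PT S n → Fin (suc n) → PT S n
sub0 u zero    = u
sub0 u (suc i) = pvar i

_[_] : PT S (suc n) → PT S n → PT S n
t [ u ] = subP (sub0 u) t

data _⟶β_ {S : Set} : ∀ {n} → PT S n → PT S n → Set where
  β     : {T : PT S n} {t : PT S (suc n)} {u : PT S n} →
          papp (plam T t) u ⟶β (t [ u ])
  Pi₁   : {A A' : PT S n} {B : PT S (suc n)} → A ⟶β A' → pPi A B ⟶β pPi A' B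
  Pi₂   : {A : PT S n} {B B' : PT S (suc n)} → B ⟶β B' → pPi A B ⟶β pPi A B'
  lam₁  : {A A' : PT S n} {t : PT S (suc n)} → A ⟶β A' → plam A t ⟶β plam A' t
  lam₂  : {A : PT S n} {t t' : PT S (suc n)} → t ⟶β t' → plam A t ⟶β plam A t'
  app₁  : {t t' u : PT S n} → t ⟶β t' → papp t u ⟶β papp t' u
  app₂  : {t u u' : PT S n} → u ⟶β u' → papp t u ⟶β papp t u'

_⟶β*_ : PT S n → PT S n → Set
_⟶β*_ = Star _⟶β_

-- PTSCα terms and lists.
--   esub N A M   is  ⟨N/x⟩_A M   (M has the extra bound variable x = index 0)
--   esubL N A l  is  ⟨N/x⟩_A l
--   meta a k Ms  is  α(M₁,…,M_k)  for the term meta-variable α = (a,k)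
--   lmeta a k Ms is  β(M₁,…,M_k)  for the list meta-variable β = (a,k)

data Tm (S : Set) : ℕ → Set
data Ls (S : Set) : ℕ → Set

data Tm S where
  Pi   : Tm S n → Tm S (suc n) → Tm S n
  lam  : Tm S n → Tm S (suc n) → Tm S n
  sort : S → Tm S n
  vapp : Fin n → Ls S n → Tm S n
  app  : Tm S n → Ls S n → Tm S n
  esub : Tm S n → Tm S n → Tm S (suc n) → Tm S n
  meta : (a k : ℕ) → Vec (Tm S n) k → Tm S n

data Ls S where
  nil   : Ls S n
  cons  : Tm S n → Ls S n → Ls S n
  cat   : Ls S n → Ls S n → Ls S n
  esubL : Tm S n → Tm S n → Ls S (suc n) → Ls S n
  lmeta : (a k : ℕ) → Vec (Tm S n) k → Ls S n

renT : (Fin n → Fin m) → Tm S n → Tm S m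
renL : (Fin n → Fin m) → Ls S n → Ls S m
renV : (Fin n → Fin m) → Vec (Tm S n) k → Vec (Tm S m) k

renT ρ (Pi A B)       = Pi (renT ρ A) (renT (extR ρ) B)
renT ρ (lam A M)      = lam (renT ρ A) (renT (extR ρ) M)
renT ρ (sort s)       = sort s
renT ρ (vapp x l)     = vapp (ρ x) (renL ρ l)
renT ρ (app M l)      = app (renT ρ M) (renL ρ l)
renT ρ (esub N A M)   = esub (renT ρ N) (renT ρ A) (renT (extR ρ) M)
renT ρ (meta a k Ms)  = meta a k (renV ρ Ms)

renL ρ nil            = nil
renL ρ (cons M l)     = cons (renT ρ M) (renL ρ l)
renL ρ (cat l l')     = cat (renL ρ l) (renL ρ l')
renL ρ (esubL N A l)  = esubL (renT ρ N) (renT ρ A) (renL (extR ρ) l)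
renL ρ (lmeta a k Ms) = lmeta a k (renV ρ Ms)

renV ρ []       = []
renV ρ (M ∷ Ms) = renT ρ M ∷ renV ρ Ms

wk : Tm S n → Tm S (suc n)
wk = renT suc

swap : Fin (suc (suc n)) → Fin (suc (suc n))
swap zero          = suc zero
swap (suc zero)    = zero
swap (suc (suc i)) = suc (suc i)

data _⟶_  {S : Set} : ∀ {n} → Tm S n → Tm S n → Set
data _⟶L_ {S : Set} : ∀ {n} → Ls S n → Ls S n → Set
data _⟶V_ {S : Set} : ∀ {n k} → Vec (Tm S n) k → Vec (Tm S n) k → Set

data _⟶_ {S} where
  rB  : {A N : Tm S n} {M : Tm S (suc n)} {l : Ls S n} →
        app (lam A M) (cons N l) ⟶ app (esub N A M) l
  rB1 : {M : Tm S n} → app M nil ⟶ M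
  rB2 : {x : Fin n} {l l' : Ls S n} → app (vapp x l) l' ⟶ vapp x (cat l l')
  rB3 : {M : Tm S n} {l l' : Ls S n} → app (app M l) l' ⟶ app M (cat l l')
  rC1 : {P G : Tm S n} {A : Tm S (suc n)} {M : Tm S (suc (suc n))} →
        esub P G (lam A M) ⟶ lam (esub P G A) (esub (wk P) (wk G) (renT swap M))
  rC2 : {P G : Tm S n} {l : Ls S (suc n)} →
        esub P G (vapp zero l) ⟶ app P (esubL P G l)
  rC3 : {P G : Tm S n} {x : Fin n} {l : Ls S (suc n)} →
        esub P G (vapp (suc x) l) ⟶ vapp x (esubL P G l)
  rC4 : {P G : Tm S n} {M : Tm S (suc n)} {l : Ls S (suc n)} →
        esub P G (app M l) ⟶ app (esub P G M) (esubL P G l)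
  rC5 : {P G : Tm S n} {A : Tm S (suc n)} {B : Tm S (suc (suc n))} →
        esub P G (Pi A B) ⟶ Pi (esub P G A) (esub (wk P) (wk G) (renT swap B))
  rC6 : {P G : Tm S n} {s : S} → esub P G (sort s) ⟶ sort s
  rCα : {P G : Tm S n} {a k : ℕ} {Ms : Vec (Tm S (suc n)) k} →
        esub P G (meta a k Ms) ⟶ meta a k (V.map (esub P G) Ms)
  cPi₁   : {A A' : Tm S n} {B : Tm S (suc n)} → A ⟶ A' → Pi A B ⟶ Pi A' B
  cPi₂   : {A : Tm S n} {B B' : Tm S (suc n)} → B ⟶ B' → Pi A B ⟶ Pi A B'
  clam₁  : {A A' : Tm S n} {M : Tm S (suc n)} → A ⟶ A' → lam A M ⟶ lam A' M
  clam₂  : {A : Tm S n} {M M' : Tm S (suc n)} → M ⟶ M' → lam A M ⟶ lam A M'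
  cvapp  : {x : Fin n} {l l' : Ls S n} → l ⟶L l' → vapp x l ⟶ vapp x l'
  capp₁  : {M M' : Tm S n} {l : Ls S n} → M ⟶ M' → app M l ⟶ app M' l
  capp₂  : {M : Tm S n} {l l' : Ls S n} → l ⟶L l' → app M l ⟶ app M l'
  cesub₁ : {N N' A : Tm S n} {M : Tm S (suc n)} → N ⟶ N' → esub N A M ⟶ esub N' A M
  cesub₂ : {N A A' : Tm S n} {M : Tm S (suc n)} → A ⟶ A' → esub N A M ⟶ esub N A' M
  cesub₃ : {N A : Tm S n} {M M' : Tm S (suc n)} → M ⟶ M' → esub N A M ⟶ esub N A M'
  cmeta  : {a k : ℕ} {Ms Ms' : Vec (Tm S n) k} → Ms ⟶V Ms' → meta a k Ms ⟶ meta a k Ms'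

data _⟶L_ {S} where
  rA1 : {M : Tm S n} {l l' : Ls S n} → cat (cons M l') l ⟶L cons M (cat l' l)
  rA2 : {l : Ls S n} → cat nil l ⟶L l
  rA3 : {l l' l'' : Ls S n} → cat (cat l l') l'' ⟶L cat l (cat l' l'')
  rA4 : {l : Ls S n} → cat l nil ⟶L l
  rD1 : {P G : Tm S n} → esubL P G nil ⟶L nil
  rD2 : {P G : Tm S n} {M : Tm S (suc n)} {l : Ls S (suc n)} →
        esubL P G (cons M l) ⟶L cons (esub P G M) (esubL P G l)
  rD3 : {P G : Tm S n} {l l' : Ls S (suc n)} →
        esubL P G (cat l l') ⟶L cat (esubL P G l) (esubL P G l')
  rDβ : {P G : Tm S n} {a k : ℕ} {Ms : Vec (Tm S (suc n)) k} →
        esubL P G (lmeta a k Ms) ⟶L lmeta a k (V.map (esub P G) Ms)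
  ccons₁  : {M M' : Tm S n} {l : Ls S n} → M ⟶ M' → cons M l ⟶L cons M' l
  ccons₂  : {M : Tm S n} {l l' : Ls S n} → l ⟶L l' → cons M l ⟶L cons M l'
  ccat₁   : {l₁ l₁' l₂ : Ls S n} → l₁ ⟶L l₁' → cat l₁ l₂ ⟶L cat l₁' l₂
  ccat₂   : {l₁ l₂ l₂' : Ls S n} → l₂ ⟶L l₂' → cat l₁ l₂ ⟶L cat l₁ l₂'
  cesubL₁ : {N N' A : Tm S n} {l : Ls S (suc n)} → N ⟶ N' → esubL N A l ⟶L esubL N' A l
  cesubL₂ : {N A A' : Tm S n} {l : Ls S (suc n)} → A ⟶ A' → esubL N A l ⟶L esubL N A' l
  cesubL₃ : {N A : Tm S n} {l l' : Ls S (suc n)} → l ⟶L l' → esubL N A l ⟶L esubL N A l'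
  clmeta  : {a k : ℕ} {Ms Ms' : Vec (Tm S n) k} → Ms ⟶V Ms' → lmeta a k Ms ⟶L lmeta a k Ms'

data _⟶V_ {S} where
  here  : {M M' : Tm S n} {Ms : Vec (Tm S n) k} → M ⟶ M' → (M ∷ Ms) ⟶V (M' ∷ Ms)
  there : {M : Tm S n} {Ms Ms' : Vec (Tm S n) k} → Ms ⟶V Ms' → (M ∷ Ms) ⟶V (M ∷ Ms')

-- The translation B.
--   ⟦ M ⟧        is  B(M)
--   ⟦ l ⟧L h     is  B^z(l){z:=h}  (z fresh); by the defining clauses this
--                    is computed directly (structural recursion), e.g.
--                    ⟦ cons M l ⟧L h = ⟦ l ⟧L (h B(M)).

⟦_⟧   : Tm S n → PT S n
⟦_⟧L  : Ls S n → PT S n → PT S n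
apps  : PT S n → Vec (Tm S n) k → PT S n

⟦ Pi A B ⟧      = pPi ⟦ A ⟧ ⟦ B ⟧
⟦ lam A M ⟧     = plam ⟦ A ⟧ ⟦ M ⟧
⟦ sort s ⟧      = psort s
⟦ vapp x l ⟧    = ⟦ l ⟧L (pvar x)
⟦ app M l ⟧     = ⟦ l ⟧L ⟦ M ⟧
⟦ esub P K M ⟧  = ⟦ M ⟧ [ ⟦ P ⟧ ]
⟦ meta a k Ms ⟧ = apps (tmv a k) Ms

⟦ nil ⟧L h          = h
⟦ cons M l ⟧L h     = ⟦ l ⟧L (papp h ⟦ M ⟧)
⟦ cat l l' ⟧L h     = ⟦ l' ⟧L (⟦ l ⟧L h)
⟦ esubL P K l ⟧L h  = (⟦ l ⟧L (renP suc h)) [ ⟦ P ⟧ ]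
⟦ lmeta a k Ms ⟧L h = apps (papp (lmv a k) h) Ms

apps h []       = h
apps h (M ∷ Ms) = apps (papp h ⟦ M ⟧) Ms

B^ : Fin n → Ls S n → PT S n
B^ y l = ⟦ l ⟧L (pvar y)

module Submission where

-- A list is translated relative
-- to a head h (⟦ l ⟧L h is B^z(l){z:=h}), and we prove the list case for an
-- ARBITRARY head, which makes the induction go through for cons, @ and ⟨/⟩.
-- The rules of x' are then simulated by zero β-steps (syntactic equality of
-- the translations) and rule B by exactly one β-step; the congruence rules
-- follow from the fact that β* is a congruence, is closed under renaming
-- and substitution, and that substitution is β*-monotone in the substituted
-- terms.

open import Defs
open import Data.Fin using (Fin; zero; suc)
open import Data.Nat using (ℕ; suc)
open import Data.Vec using (Vec; []; _∷_)
import Data.Vec as V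
open import Data.Product using (_×_; _,_)
open import Function using (_∘_)
open import Relation.Binary.PropositionalEquality
  using (_≡_; refl; sym; trans; cong; cong₂; subst; module ≡-Reasoning)
open import Relation.Binary.Construct.Closure.ReflexiveTransitive
  using (ε; _◅_; _◅◅_; gmap)
open import Relation.Binary.Construct.Closure.ReflexiveTransitive.Properties
  using (reflexive)

variable
  p : ℕ

-- 1. Renaming and substitution on PTS terms

extR-cong : {ρ ρ' : Fin n → Fin m} → (∀ i → ρ i ≡ ρ' i) → ∀ i → extR ρ i ≡ extR ρ' i
extR-cong e zero    = refl
extR-cong e (suc i) = cong suc (e i)

renP-cong : {ρ ρ' : Fin n → Fin m} → (∀ i → ρ i ≡ ρ' i) → (t : PT S n) → renP ρ t ≡ renP ρ' t
renP-cong e (pvar x)   = cong pvar (e x)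
renP-cong e (psort s)  = refl
renP-cong e (pPi A B)  = cong₂ pPi (renP-cong e A) (renP-cong (extR-cong e) B)
renP-cong e (plam A t) = cong₂ plam (renP-cong e A) (renP-cong (extR-cong e) t)
renP-cong e (papp t u) = cong₂ papp (renP-cong e t) (renP-cong e u)
renP-cong e (tmv a k)  = refl
renP-cong e (lmv a k)  = refl

extS-cong : {σ σ' : Fin n → PT S m} → (∀ i → σ i ≡ σ' i) → ∀ i → extS σ i ≡ extS σ' i
extS-cong e zero    = refl
extS-cong e (suc i) = cong (renP suc) (e i)

subP-cong : {σ σ' : Fin n → PT S m} → (∀ i → σ i ≡ σ' i) → (t : PT S n) → subP σ t ≡ subP σ' t
subP-cong e (pvar x)   = e x
subP-cong e (psort s)  = refl
subP-cong e (pPi A B)  = cong₂ pPi (subP-cong e A) (subP-cong (extS-cong e) B)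
subP-cong e (plam A t) = cong₂ plam (subP-cong e A) (subP-cong (extS-cong e) t)
subP-cong e (papp t u) = cong₂ papp (subP-cong e t) (subP-cong e u)
subP-cong e (tmv a k)  = refl
subP-cong e (lmv a k)  = refl

extR-∘ : (ρ : Fin m → Fin p) (ρ' : Fin n → Fin m) → ∀ i → extR ρ (extR ρ' i) ≡ extR (ρ ∘ ρ') i
extR-∘ ρ ρ' zero    = refl
extR-∘ ρ ρ' (suc i) = refl

ren-ren : (ρ : Fin m → Fin p) (ρ' : Fin n → Fin m) (t : PT S n) →
          renP ρ (renP ρ' t) ≡ renP (ρ ∘ ρ') t
ren-ren ρ ρ' (pvar x)   = refl
ren-ren ρ ρ' (psort s)  = refl
ren-ren ρ ρ' (pPi A B)  = cong₂ pPi (ren-ren ρ ρ' A)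
  (trans (ren-ren (extR ρ) (extR ρ') B) (renP-cong (extR-∘ ρ ρ') B))
ren-ren ρ ρ' (plam A t) = cong₂ plam (ren-ren ρ ρ' A)
  (trans (ren-ren (extR ρ) (extR ρ') t) (renP-cong (extR-∘ ρ ρ') t))
ren-ren ρ ρ' (papp t u) = cong₂ papp (ren-ren ρ ρ' t) (ren-ren ρ ρ' u)
ren-ren ρ ρ' (tmv a k)  = refl
ren-ren ρ ρ' (lmv a k)  = refl

extS-extR : (σ : Fin m → PT S p) (ρ : Fin n → Fin m) → ∀ i → extS σ (extR ρ i) ≡ extS (σ ∘ ρ) i
extS-extR σ ρ zero    = refl
extS-extR σ ρ (suc i) = refl

sub-ren : (σ : Fin m → PT S p) (ρ : Fin n → Fin m) (t : PT S n) →
          subP σ (renP ρ t) ≡ subP (σ ∘ ρ) t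
sub-ren σ ρ (pvar x)   = refl
sub-ren σ ρ (psort s)  = refl
sub-ren σ ρ (pPi A B)  = cong₂ pPi (sub-ren σ ρ A)
  (trans (sub-ren (extS σ) (extR ρ) B) (subP-cong (extS-extR σ ρ) B))
sub-ren σ ρ (plam A t) = cong₂ plam (sub-ren σ ρ A)
  (trans (sub-ren (extS σ) (extR ρ) t) (subP-cong (extS-extR σ ρ) t))
sub-ren σ ρ (papp t u) = cong₂ papp (sub-ren σ ρ t) (sub-ren σ ρ u)
sub-ren σ ρ (tmv a k)  = refl
sub-ren σ ρ (lmv a k)  = refl

extR-extS : (ρ : Fin m → Fin p) (σ : Fin n → PT S m) →
            ∀ i → renP (extR ρ) (extS σ i) ≡ extS (renP ρ ∘ σ) i
extR-extS ρ σ zero    = refl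
extR-extS ρ σ (suc i) = trans (ren-ren (extR ρ) suc (σ i)) (sym (ren-ren suc ρ (σ i)))

ren-sub : (ρ : Fin m → Fin p) (σ : Fin n → PT S m) (t : PT S n) →
          renP ρ (subP σ t) ≡ subP (renP ρ ∘ σ) t
ren-sub ρ σ (pvar x)   = refl
ren-sub ρ σ (psort s)  = refl
ren-sub ρ σ (pPi A B)  = cong₂ pPi (ren-sub ρ σ A)
  (trans (ren-sub (extR ρ) (extS σ) B) (subP-cong (extR-extS ρ σ) B))
ren-sub ρ σ (plam A t) = cong₂ plam (ren-sub ρ σ A)
  (trans (ren-sub (extR ρ) (extS σ) t) (subP-cong (extR-extS ρ σ) t))
ren-sub ρ σ (papp t u) = cong₂ papp (ren-sub ρ σ t) (ren-sub ρ σ u)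
ren-sub ρ σ (tmv a k)  = refl
ren-sub ρ σ (lmv a k)  = refl

subP-wk : (σ : Fin n → PT S m) (t : PT S n) → subP (extS σ) (renP suc t) ≡ renP suc (subP σ t)
subP-wk σ t = trans (sub-ren (extS σ) suc t) (sym (ren-sub suc σ t))

extS-extS : (σ : Fin m → PT S p) (τ : Fin n → PT S m) →
            ∀ i → subP (extS σ) (extS τ i) ≡ extS (subP σ ∘ τ) i
extS-extS σ τ zero    = refl
extS-extS σ τ (suc i) = subP-wk σ (τ i)

sub-sub : (σ : Fin m → PT S p) (τ : Fin n → PT S m) (t : PT S n) →
          subP σ (subP τ t) ≡ subP (subP σ ∘ τ) t
sub-sub σ τ (pvar x)   = refl
sub-sub σ τ (psort s)  = refl
sub-sub σ τ (pPi A B)  = cong₂ pPi (sub-sub σ τ A)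
  (trans (sub-sub (extS σ) (extS τ) B) (subP-cong (extS-extS σ τ) B))
sub-sub σ τ (plam A t) = cong₂ plam (sub-sub σ τ A)
  (trans (sub-sub (extS σ) (extS τ) t) (subP-cong (extS-extS σ τ) t))
sub-sub σ τ (papp t u) = cong₂ papp (sub-sub σ τ t) (sub-sub σ τ u)
sub-sub σ τ (tmv a k)  = refl
sub-sub σ τ (lmv a k)  = refl

extS-pvar : ∀ i → extS {m = n} (pvar {S = S}) i ≡ pvar i
extS-pvar zero    = refl
extS-pvar (suc i) = refl

sub-id : (t : PT S n) → subP pvar t ≡ t
sub-id (pvar x)   = refl
sub-id (psort s)  = refl
sub-id (pPi A B)  = cong₂ pPi (sub-id A) (trans (subP-cong extS-pvar B) (sub-id B))
sub-id (plam A t) = cong₂ plam (sub-id A) (trans (subP-cong extS-pvar t) (sub-id t))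
sub-id (papp t u) = cong₂ papp (sub-id t) (sub-id u)
sub-id (tmv a k)  = refl
sub-id (lmv a k)  = refl

wk-[] : (t u : PT S n) → renP suc t [ u ] ≡ t
wk-[] t u = trans (sub-ren (sub0 u) suc t) (sub-id t)

subP-[] : (σ : Fin n → PT S m) (t : PT S (suc n)) (u : PT S n) →
          subP σ (t [ u ]) ≡ subP (extS σ) t [ subP σ u ]
subP-[] σ t u = begin
  subP σ (subP (sub0 u) t)                   ≡⟨ sub-sub σ (sub0 u) t ⟩
  subP (subP σ ∘ sub0 u) t                   ≡⟨ subP-cong agree t ⟩
  subP (subP (sub0 (subP σ u)) ∘ extS σ) t   ≡⟨ sym (sub-sub (sub0 (subP σ u)) (extS σ) t) ⟩
  subP (extS σ) t [ subP σ u ]               ∎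
  where
  open ≡-Reasoning
  agree : ∀ i → subP σ (sub0 u i) ≡ subP (sub0 (subP σ u)) (extS σ i)
  agree zero    = refl
  agree (suc i) = sym (wk-[] (σ i) (subP σ u))

renP-[] : (ρ : Fin n → Fin m) (t : PT S (suc n)) (u : PT S n) →
          renP ρ (t [ u ]) ≡ renP (extR ρ) t [ renP ρ u ]
renP-[] ρ t u = begin
  renP ρ (subP (sub0 u) t)                   ≡⟨ ren-sub ρ (sub0 u) t ⟩
  subP (renP ρ ∘ sub0 u) t                   ≡⟨ subP-cong agree t ⟩
  subP (sub0 (renP ρ u) ∘ extR ρ) t          ≡⟨ sym (sub-ren (sub0 (renP ρ u)) (extR ρ) t) ⟩
  renP (extR ρ) t [ renP ρ u ]               ∎
  where
  open ≡-Reasoning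
  agree : ∀ i → renP ρ (sub0 u i) ≡ sub0 (renP ρ u) (extR ρ i)
  agree zero    = refl
  agree (suc i) = refl

extS-sub0-swap : (t : PT S (suc (suc n))) (u : PT S n) →
                 subP (extS (sub0 u)) t ≡ renP swap t [ renP suc u ]
extS-sub0-swap t u = trans (subP-cong agree t) (sym (sub-ren (sub0 (renP suc u)) swap t))
  where
  agree : ∀ i → extS (sub0 u) i ≡ sub0 (renP suc u) (swap i)
  agree zero          = refl
  agree (suc zero)    = refl
  agree (suc (suc i)) = refl

-- 2. Closure properties of β and β*

≡⇒β* : {t u : PT S n} → t ≡ u → t ⟶β* u
≡⇒β* = reflexive _⟶β_

Pi₁* : {A A' : PT S n} {B : PT S (suc n)} → A ⟶β* A' → pPi A B ⟶β* pPi A' B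
Pi₁* {B = B} = gmap (λ A → pPi A B) Pi₁

Pi₂* : {A : PT S n} {B B' : PT S (suc n)} → B ⟶β* B' → pPi A B ⟶β* pPi A B'
Pi₂* {A = A} = gmap (pPi A) Pi₂

lam₁* : {A A' : PT S n} {t : PT S (suc n)} → A ⟶β* A' → plam A t ⟶β* plam A' t
lam₁* {t = t} = gmap (λ A → plam A t) lam₁

lam₂* : {A : PT S n} {t t' : PT S (suc n)} → t ⟶β* t' → plam A t ⟶β* plam A t'
lam₂* {A = A} = gmap (plam A) lam₂

app₁* : {t t' u : PT S n} → t ⟶β* t' → papp t u ⟶β* papp t' u
app₁* {u = u} = gmap (λ t → papp t u) app₁

app₂* : {t u u' : PT S n} → u ⟶β* u' → papp t u ⟶β* papp t u'
app₂* {t = t} = gmap (papp t) app₂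

renP-⟶β : (ρ : Fin n → Fin m) {t t' : PT S n} → t ⟶β t' → renP ρ t ⟶β renP ρ t'
renP-⟶β ρ (β {T = T} {t} {u}) =
  subst (renP ρ (papp (plam T t) u) ⟶β_) (sym (renP-[] ρ t u)) β
renP-⟶β ρ (Pi₁ r)  = Pi₁ (renP-⟶β ρ r)
renP-⟶β ρ (Pi₂ r)  = Pi₂ (renP-⟶β (extR ρ) r)
renP-⟶β ρ (lam₁ r) = lam₁ (renP-⟶β ρ r)
renP-⟶β ρ (lam₂ r) = lam₂ (renP-⟶β (extR ρ) r)
renP-⟶β ρ (app₁ r) = app₁ (renP-⟶β ρ r)
renP-⟶β ρ (app₂ r) = app₂ (renP-⟶β ρ r)

subP-⟶β : (σ : Fin n → PT S m) {t t' : PT S n} → t ⟶β t' → subP σ t ⟶β subP σ t'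
subP-⟶β σ (β {T = T} {t} {u}) =
  subst (subP σ (papp (plam T t) u) ⟶β_) (sym (subP-[] σ t u)) β
subP-⟶β σ (Pi₁ r)  = Pi₁ (subP-⟶β σ r)
subP-⟶β σ (Pi₂ r)  = Pi₂ (subP-⟶β (extS σ) r)
subP-⟶β σ (lam₁ r) = lam₁ (subP-⟶β σ r)
subP-⟶β σ (lam₂ r) = lam₂ (subP-⟶β (extS σ) r)
subP-⟶β σ (app₁ r) = app₁ (subP-⟶β σ r)
subP-⟶β σ (app₂ r) = app₂ (subP-⟶β σ r)

renP-⟶β* : (ρ : Fin n → Fin m) {t t' : PT S n} → t ⟶β* t' → renP ρ t ⟶β* renP ρ t'
renP-⟶β* ρ = gmap (renP ρ) (renP-⟶β ρ)

subP-⟶β* : (σ : Fin n → PT S m) {t t' : PT S n} → t ⟶β* t' → subP σ t ⟶β* subP σ t'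
subP-⟶β* σ = gmap (subP σ) (subP-⟶β σ)

extS-⟶β* : {σ σ' : Fin n → PT S m} → (∀ i → σ i ⟶β* σ' i) → ∀ i → extS σ i ⟶β* extS σ' i
extS-⟶β* rs zero    = ε
extS-⟶β* rs (suc i) = renP-⟶β* suc (rs i)

subP-args-⟶β* : {σ σ' : Fin n → PT S m} → (∀ i → σ i ⟶β* σ' i) →
                (t : PT S n) → subP σ t ⟶β* subP σ' t
subP-args-⟶β* rs (pvar x)   = rs x
subP-args-⟶β* rs (psort s)  = ε
subP-args-⟶β* rs (pPi A B)  = Pi₁* (subP-args-⟶β* rs A) ◅◅ Pi₂* (subP-args-⟶β* (extS-⟶β* rs) B)
subP-args-⟶β* rs (plam A t) = lam₁* (subP-args-⟶β* rs A) ◅◅ lam₂* (subP-args-⟶β* (extS-⟶β* rs) t)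
subP-args-⟶β* rs (papp t u) = app₁* (subP-args-⟶β* rs t) ◅◅ app₂* (subP-args-⟶β* rs u)
subP-args-⟶β* rs (tmv a k)  = ε
subP-args-⟶β* rs (lmv a k)  = ε

[]-arg-⟶β* : (t : PT S (suc n)) {u u' : PT S n} → u ⟶β* u' → (t [ u ]) ⟶β* (t [ u' ])
[]-arg-⟶β* t {u} {u'} r = subP-args-⟶β* sub0-⟶β* t
  where
  sub0-⟶β* : ∀ i → sub0 u i ⟶β* sub0 u' i
  sub0-⟶β* zero    = r
  sub0-⟶β* (suc i) = ε

-- 3. The translation

apps-head-⟶β* : (Ms : Vec (Tm S n) k) {h h' : PT S n} → h ⟶β* h' → apps h Ms ⟶β* apps h' Ms
apps-head-⟶β* []       r = r
apps-head-⟶β* (M ∷ Ms) r = apps-head-⟶β* Ms (app₁* r)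

⟦⟧L-head-⟶β* : (l : Ls S n) {h h' : PT S n} → h ⟶β* h' → ⟦ l ⟧L h ⟶β* ⟦ l ⟧L h'
⟦⟧L-head-⟶β* nil            r = r
⟦⟧L-head-⟶β* (cons M l)     r = ⟦⟧L-head-⟶β* l (app₁* r)
⟦⟧L-head-⟶β* (cat l l')     r = ⟦⟧L-head-⟶β* l' (⟦⟧L-head-⟶β* l r)
⟦⟧L-head-⟶β* (esubL P K l)  r = subP-⟶β* (sub0 ⟦ P ⟧) (⟦⟧L-head-⟶β* l (renP-⟶β* suc r))
⟦⟧L-head-⟶β* (lmeta a k Ms) r = apps-head-⟶β* Ms (app₂* r)

⟦⟧-ren    : (ρ : Fin n → Fin m) (M : Tm S n) → ⟦ renT ρ M ⟧ ≡ renP ρ ⟦ M ⟧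
⟦⟧L-ren   : (ρ : Fin n → Fin m) (l : Ls S n) (h : PT S n) →
            ⟦ renL ρ l ⟧L (renP ρ h) ≡ renP ρ (⟦ l ⟧L h)
apps-ren  : (ρ : Fin n → Fin m) (Ms : Vec (Tm S n) k) (h : PT S n) →
            apps (renP ρ h) (renV ρ Ms) ≡ renP ρ (apps h Ms)

⟦⟧-ren ρ (Pi A B)      = cong₂ pPi (⟦⟧-ren ρ A) (⟦⟧-ren (extR ρ) B)
⟦⟧-ren ρ (lam A M)     = cong₂ plam (⟦⟧-ren ρ A) (⟦⟧-ren (extR ρ) M)
⟦⟧-ren ρ (sort s)      = refl
⟦⟧-ren ρ (vapp x l)    = ⟦⟧L-ren ρ l (pvar x)
⟦⟧-ren ρ (app M l)     = trans (cong ⟦ renL ρ l ⟧L (⟦⟧-ren ρ M)) (⟦⟧L-ren ρ l ⟦ M ⟧)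
⟦⟧-ren ρ (esub P K M)  =
  trans (cong₂ _[_] (⟦⟧-ren (extR ρ) M) (⟦⟧-ren ρ P)) (sym (renP-[] ρ ⟦ M ⟧ ⟦ P ⟧))
⟦⟧-ren ρ (meta a k Ms) = apps-ren ρ Ms (tmv a k)

⟦⟧L-ren ρ nil h            = refl
⟦⟧L-ren ρ (cons M l) h     =
  trans (cong (λ t → ⟦ renL ρ l ⟧L (papp (renP ρ h) t)) (⟦⟧-ren ρ M)) (⟦⟧L-ren ρ l (papp h ⟦ M ⟧))
⟦⟧L-ren ρ (cat l l') h     = trans (cong ⟦ renL ρ l' ⟧L (⟦⟧L-ren ρ l h)) (⟦⟧L-ren ρ l' (⟦ l ⟧L h))
⟦⟧L-ren ρ (esubL P K l) h  = begin
  ⟦ renL (extR ρ) l ⟧L (renP suc (renP ρ h)) [ ⟦ renT ρ P ⟧ ]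
    ≡⟨ cong₂ (λ t u → ⟦ renL (extR ρ) l ⟧L t [ u ]) wk-ren (⟦⟧-ren ρ P) ⟩
  ⟦ renL (extR ρ) l ⟧L (renP (extR ρ) (renP suc h)) [ renP ρ ⟦ P ⟧ ]
    ≡⟨ cong (_[ renP ρ ⟦ P ⟧ ]) (⟦⟧L-ren (extR ρ) l (renP suc h)) ⟩
  renP (extR ρ) (⟦ l ⟧L (renP suc h)) [ renP ρ ⟦ P ⟧ ]
    ≡⟨ sym (renP-[] ρ (⟦ l ⟧L (renP suc h)) ⟦ P ⟧) ⟩
  renP ρ (⟦ l ⟧L (renP suc h) [ ⟦ P ⟧ ])
    ∎
  where
  open ≡-Reasoning
  wk-ren : renP suc (renP ρ h) ≡ renP (extR ρ) (renP suc h)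
  wk-ren = trans (ren-ren suc ρ h) (sym (ren-ren (extR ρ) suc h))
⟦⟧L-ren ρ (lmeta a k Ms) h = apps-ren ρ Ms (papp (lmv a k) h)

apps-ren ρ []       h = refl
apps-ren ρ (M ∷ Ms) h =
  trans (cong (λ t → apps (papp (renP ρ h) t) (renV ρ Ms)) (⟦⟧-ren ρ M)) (apps-ren ρ Ms (papp h ⟦ M ⟧))

apps-subst-head : (σ : Fin n → PT S m) (Ms : Vec (Tm S n) k) {h h' : PT S n} →
                  subP σ h ≡ subP σ h' → subP σ (apps h Ms) ≡ subP σ (apps h' Ms)
apps-subst-head σ []       e = e
apps-subst-head σ (M ∷ Ms) e = apps-subst-head σ Ms (cong (λ t → papp t (subP σ ⟦ M ⟧)) e)

⟦⟧L-subst-head : (σ : Fin n → PT S m) (l : Ls S n) {h h' : PT S n} →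
                 subP σ h ≡ subP σ h' → subP σ (⟦ l ⟧L h) ≡ subP σ (⟦ l ⟧L h')
⟦⟧L-subst-head σ nil            e = e
⟦⟧L-subst-head σ (cons M l)     e = ⟦⟧L-subst-head σ l (cong (λ t → papp t (subP σ ⟦ M ⟧)) e)
⟦⟧L-subst-head σ (cat l l')     e = ⟦⟧L-subst-head σ l' (⟦⟧L-subst-head σ l e)
⟦⟧L-subst-head σ (esubL P K l) {h} {h'} e = begin
  subP σ (⟦ l ⟧L (renP suc h) [ ⟦ P ⟧ ])
    ≡⟨ subP-[] σ (⟦ l ⟧L (renP suc h)) ⟦ P ⟧ ⟩
  subP (extS σ) (⟦ l ⟧L (renP suc h)) [ subP σ ⟦ P ⟧ ]
    ≡⟨ cong (_[ subP σ ⟦ P ⟧ ]) (⟦⟧L-subst-head (extS σ) l lifted) ⟩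
  subP (extS σ) (⟦ l ⟧L (renP suc h')) [ subP σ ⟦ P ⟧ ]
    ≡⟨ sym (subP-[] σ (⟦ l ⟧L (renP suc h')) ⟦ P ⟧) ⟩
  subP σ (⟦ l ⟧L (renP suc h') [ ⟦ P ⟧ ])
    ∎
  where
  open ≡-Reasoning
  lifted : subP (extS σ) (renP suc h) ≡ subP (extS σ) (renP suc h')
  lifted = trans (subP-wk σ h) (trans (cong (renP suc) e) (sym (subP-wk σ h')))
⟦⟧L-subst-head σ (lmeta a k Ms) e = apps-subst-head σ Ms (cong (papp (lmv a k)) e)

-- Translating ⟨P/x⟩ l with head h' gives the instance {x:=B(P)} of the
-- translation of l with any head h whose instance is h'.  This single fact
-- covers rules C2, C4, D2 and D3.
⟦esubL⟧L : (P G : Tm S n) (l : Ls S (suc n)) {h : PT S (suc n)} {h' : PT S n} →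
           h [ ⟦ P ⟧ ] ≡ h' → ⟦ esubL P G l ⟧L h' ≡ (⟦ l ⟧L h [ ⟦ P ⟧ ])
⟦esubL⟧L P G l {h} {h'} e =
  ⟦⟧L-subst-head (sub0 ⟦ P ⟧) l (trans (wk-[] h' ⟦ P ⟧) (sym e))

apps-[] : (P G : Tm S n) (Ms : Vec (Tm S (suc n)) k) (h : PT S (suc n)) →
          (apps h Ms [ ⟦ P ⟧ ]) ≡ apps (h [ ⟦ P ⟧ ]) (V.map (esub P G) Ms)
apps-[] P G []       h = refl
apps-[] P G (M ∷ Ms) h = apps-[] P G Ms (papp h ⟦ M ⟧)

⟦esub-under-binder⟧ : (P G : Tm S n) (M : Tm S (suc (suc n))) →
                      ⟦ esub (wk P) (wk G) (renT swap M) ⟧ ≡ subP (extS (sub0 ⟦ P ⟧)) ⟦ M ⟧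
⟦esub-under-binder⟧ P G M =
  trans (cong₂ _[_] (⟦⟧-ren swap M) (⟦⟧-ren suc P)) (sym (extS-sub0-swap ⟦ M ⟧ ⟦ P ⟧))

-- 4. The simulation

simulate  : {M N : Tm S n} → M ⟶ N → ⟦ M ⟧ ⟶β* ⟦ N ⟧
simulateL : {l l' : Ls S n} → l ⟶L l' → (h : PT S n) → ⟦ l ⟧L h ⟶β* ⟦ l' ⟧L h
simulateV : {Ms Ms' : Vec (Tm S n) k} → Ms ⟶V Ms' → (h : PT S n) → apps h Ms ⟶β* apps h Ms'

simulate (rB {l = l})                     = ⟦⟧L-head-⟶β* l (β ◅ ε)
simulate rB1                              = ε
simulate rB2                              = ε
simulate rB3                              = ε
simulate (rC1 {P = P} {G} {M = M})        = ≡⇒β* (cong (plam _) (sym (⟦esub-under-binder⟧ P G M)))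
simulate (rC2 {P = P} {G} {l})            = ≡⇒β* (sym (⟦esubL⟧L P G l refl))
simulate rC3                              = ε
simulate (rC4 {P = P} {G} {l = l})        = ≡⇒β* (sym (⟦esubL⟧L P G l refl))
simulate (rC5 {P = P} {G} {B = B})        = ≡⇒β* (cong (pPi _) (sym (⟦esub-under-binder⟧ P G B)))
simulate rC6                              = ε
simulate (rCα {P = P} {G} {a} {k} {Ms})   = ≡⇒β* (apps-[] P G Ms (tmv a k))
simulate (cPi₁ r)                         = Pi₁* (simulate r)
simulate (cPi₂ r)                         = Pi₂* (simulate r)
simulate (clam₁ r)                        = lam₁* (simulate r)
simulate (clam₂ r)                        = lam₂* (simulate r)
simulate (cvapp {x = x} r)                = simulateL r (pvar x)
simulate (capp₁ {l = l} r)                = ⟦⟧L-head-⟶β* l (simulate r)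
simulate (capp₂ {M = M} r)                = simulateL r ⟦ M ⟧
simulate (cesub₁ {M = M} r)               = []-arg-⟶β* ⟦ M ⟧ (simulate r)
simulate (cesub₂ r)                       = ε
simulate (cesub₃ {N = N} r)               = subP-⟶β* (sub0 ⟦ N ⟧) (simulate r)
simulate (cmeta {a = a} {k} r)            = simulateV r (tmv a k)

simulateL rA1 h                                = ε
simulateL rA2 h                                = ε
simulateL rA3 h                                = ε
simulateL rA4 h                                = ε
simulateL (rD1 {P = P}) h                      = ≡⇒β* (wk-[] h ⟦ P ⟧)
simulateL (rD2 {P = P} {G} {l = l}) h          =
  ≡⇒β* (sym (⟦esubL⟧L P G l (cong (λ t → papp t _) (wk-[] h ⟦ P ⟧))))
simulateL (rD3 {P = P} {G} {l' = l'}) h        = ≡⇒β* (sym (⟦esubL⟧L P G l' refl))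
simulateL (rDβ {P = P} {G} {a} {k} {Ms}) h     =
  ≡⇒β* (trans (apps-[] P G Ms (papp (lmv a k) (renP suc h)))
              (cong (λ t → apps (papp (lmv a k) t) (V.map (esub P G) Ms)) (wk-[] h ⟦ P ⟧)))
simulateL (ccons₁ {l = l} r) h                 = ⟦⟧L-head-⟶β* l (app₂* (simulate r))
simulateL (ccons₂ {M = M} r) h                 = simulateL r (papp h ⟦ M ⟧)
simulateL (ccat₁ {l₂ = l₂} r) h                = ⟦⟧L-head-⟶β* l₂ (simulateL r h)
simulateL (ccat₂ {l₁ = l₁} r) h                = simulateL r (⟦ l₁ ⟧L h)
simulateL (cesubL₁ {l = l} r) h                = []-arg-⟶β* (⟦ l ⟧L (renP suc h)) (simulate r)
simulateL (cesubL₂ r) h                        = ε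
simulateL (cesubL₃ {N = N} r) h                = subP-⟶β* (sub0 ⟦ N ⟧) (simulateL r (renP suc h))
simulateL (clmeta {a = a} {k} r) h             = simulateV r (papp (lmv a k) h)

simulateV (here {Ms = Ms} r) h  = apps-head-⟶β* Ms (app₂* (simulate r))
simulateV (there {M = M} r) h   = simulateV r (papp h ⟦ M ⟧)

theorem2p2 : {S : Set} →
    (∀ {n} {M N : Tm S n} → M ⟶ N → ⟦ M ⟧ ⟶β* ⟦ N ⟧) ×
    (∀ {n} {l l' : Ls S n} (y : Fin n) → l ⟶L l' → B^ y l ⟶β* B^ y l')
theorem2p2 = simulate , λ y r → simulateL r (pvar y)
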